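{- Let $(V,\mathcal G)$ be an antimatroid with path poset $(Q,\supseteq)$. Then there is a set $\Omega$ of $O(|V|)$ complement join constraints on the trivial poset $(V,\sim)$, each with $O(|Q|^2)$ arguments, such that $$\mathcal G=\{T\in\mathcal D^c(V)\mid T\text{ satisfies }(\beta^c,\alpha^c)\ \forall(\beta^c,\alpha^c)\in\Omega\}.$$
   Context: An antimatroid $(V,\mathcal G)$ is a finite set $V$ with a nonempty family $\mathcal G\subseteq 2^V$ (feasible sets) such that $V\in\mathcal G$; $G_1,G_2\in\mathcal G$ implies $G_1\cup G_2\in\mathcal G$; and every nonempty $G\in\mathcal G$ has some $g\in G$ with $G\setminus\{g\}\in\mathcal G$. An endpoint of $G\in\mathcal G$ is $g\in G$ with $G\setminus\{g\}\in\mathcal G$; a path is a feasible set with exactly one endpoint; $Q$ is the set of paths, ordered by $\supseteq$ (the path poset). The trivial poset $(V,\sim)$ has $x\sim y$ iff $x=y$; $\mathcal D^c(V)$, its set of upper closed sets, equals $2^V$. A join constraint on $(V,\sim)$ is a pair $(\alpha,\beta)$ with $\alpha(T)=(\mathbf 1_{b_{11}}(T)\vee\mathbf 1_{b_{12}}(T)\vee\cdots)\wedge(\mathbf 1_{b_{21}}(T)\vee\cdots)\wedge\cdots$ and $\beta(T)=\mathbf 1_{b_1}(T)\wedge\mathbf 1_{b_2}(T)\wedge\cdots$ for elements $b_{ik},b_i\in V$ (its arguments), where $\mathbf 1_b(T)$ indicates $b\in T$. Its complement $(\beta^c,\alpha^c)$ is given by $\beta^c(T)=\mathbf 1_{b_1}(T)\vee\mathbf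 1_{b_2}(T)\vee\cdots$ and $\alpha^c(T)=(\mathbf 1_{b_{11}}(T)\wedge\mathbf 1_{b_{12}}(T)\wedge\cdots)\vee(\mathbf 1_{b_{21}}(T)\wedge\cdots)\vee\cdots$; a complement join constraint is such a pair, and a set $T$ satisfies $(\beta^c,\alpha^c)$ if $\beta^c(T)=1$ implies $\alpha^c(T)=1$. -}

module Defs where

open import Data.Nat using (ℕ; zero; suc; _+_; _*_; _≡ᵇ_)
open import Data.Bool using (Bool; true; false; _∧_)
open import Data.Fin using (Fin)
open import Data.Fin.Subset using (Subset; _∈_; _∪_; _-_; ⊤; Nonempty)
open import Data.Vec using (Vec; []; _∷_; lookup)
open import Data.List using (List; []; _∷_; map; _++_; length; filterᵇ; allFin)
open import Data.Nat.ListAction using (sum)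
open import Data.List.NonEmpty using (List⁺; toList)
import Data.List.NonEmpty as L⁺
open import Data.List.Relation.Unary.Any using (Any)
open import Data.List.Relation.Unary.All using (All)
open import Data.Product using (Σ; ∃; _×_)
open import Relation.Binary.PropositionalEquality using (_≡_)

Family : ℕ → Set
Family n = Subset n → Bool

Feasible : ∀ {n} → Family n → Subset n → Set
Feasible F G = F G ≡ true

-- Antimatroid axioms (nonemptiness of the family follows from V ∈ 𝒢).
record IsAntimatroid {n : ℕ} (F : Family n) : Set where
  field
    full-feasible : Feasible F ⊤
    union-closed  : ∀ G₁ G₂ → Feasible F G₁ → Feasible F G₂ → Feasible F (G₁ ∪ G₂)
    accessible    : ∀ G → Feasible F G → Nonempty G →
                    ∃ λ g → g ∈ G × Feasible F (G - g)

allSubsets : ∀ n → List (Subset n)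
allSubsets zero    = [] ∷ []
allSubsets (suc n) = map (true ∷_) (allSubsets n) ++ map (false ∷_) (allSubsets n)

isEndpointᵇ : ∀ {n} → Family n → Subset n → Fin n → Bool
isEndpointᵇ F G g = lookup G g ∧ F (G - g)

numEndpoints : ∀ {n} → Family n → Subset n → ℕ
numEndpoints {n} F G = length (filterᵇ (isEndpointᵇ F G) (allFin n))

isPathᵇ : ∀ {n} → Family n → Subset n → Bool
isPathᵇ F G = F G ∧ (numEndpoints F G ≡ᵇ 1)

numPaths : ∀ {n} → Family n → ℕ
numPaths {n} F = length (filterᵇ (isPathᵇ F) (allSubsets n))

-- A complement join constraint (β^c, α^c) on the trivial poset (Fin n, =).
-- betaArgs  = [b₁, b₂, …]                 : β^c(T) = ∨ᵢ 1_{bᵢ}(T)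
-- alphaArgs = [[b₁₁, b₁₂, …], [b₂₁, …], …] : α^c(T) = ∨ᵢ ∧ₖ 1_{bᵢₖ}(T)
record ComplJoinConstraint (n : ℕ) : Set where
  constructor cjc
  field
    betaArgs  : List⁺ (Fin n)
    alphaArgs : List⁺ (List⁺ (Fin n))

open ComplJoinConstraint public

βᶜ : ∀ {n} → ComplJoinConstraint n → Subset n → Set
βᶜ c T = Any (_∈ T) (toList (betaArgs c))

αᶜ : ∀ {n} → ComplJoinConstraint n → Subset n → Set
αᶜ c T = Any (λ clause → All (_∈ T) (toList clause)) (toList (alphaArgs c))

Satisfies : ∀ {n} → Subset n → ComplJoinConstraint n → Set
Satisfies T c = βᶜ c T → αᶜ c T

numArgs : ∀ {n} → ComplJoinConstraint n → ℕ
numArgs c = L⁺.length (betaArgs c) + sum (map L⁺.length (toList (alphaArgs c)))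

-- For x ∈ V take the constraint "x ∈ T implies that T contains a path with
-- endpoint x": βᶜ = 1ₓ, and αᶜ has one conjunctive clause {x} ∪ P for each such
-- path P.  A feasible T satisfies it: delete endpoints other than x from T while
-- there are any; what remains is feasible and, by accessibility, has x as its
-- only endpoint.  Conversely, if T satisfies all constraints it is a union of
-- feasible sets, hence feasible (union closure; the empty union ∅ is feasible
-- again by accessibility).  There are at most |Q| + 1 clauses of at most
-- |V| + 1 arguments each, and |V| ≤ |Q| because a path has a single endpoint,
-- so x ↦ (a path with endpoint x) is injective.

module Submission where

open import Defs
open import Data.Nat using (ℕ; _+_; _*_; _≤_)
open import Data.Fin.Subset using (Subset)
open import Data.List using (List; length)
open import Data.List.Membership.Propositional using (_∈_)
open import Data.List.Relation.Unary.All using (All)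
open import Data.Product using (∃; _×_)
open import Function.Bundles using (_⇔_)

open import Data.Bool using (Bool; true; false; _∧_; T; T?)
open import Data.Bool.Properties using (T-≡) renaming (_≟_ to _≟ᵇ_)
open import Data.Empty using (⊥-elim)
open import Data.Fin using (Fin; zero; suc)
open import Data.Fin.Properties using (any?; 0≢1+n; suc-injective; injective⇒≤)
open import Data.Fin.Subset using (_⊆_; _⊂_; _∪_; _-_; ⁅_⁆; ⊤; ⊥; Empty)
  renaming (_∈_ to _∈ˢ_)
open import Data.Fin.Subset.Induction using (⊂-wellFounded)
open import Data.Fin.Subset.Properties
  using (_∈?_; ∈⊤; ∉⊥; ⊆-min; ⊆-refl; ⊆-trans; ⊆-antisym; Empty-unique; x∈⁅x⁆; x∈⁅y⁆⇒x≡y;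
         p─q⊆p; x∈p⇒p-x⊂p; x∈p∧x≢y⇒x∈p-y; x∈p∪q⁺; x∈p∪q⁻)
open import Data.List using ([]; _∷_; map; filterᵇ; tabulate; allFin)
open import Data.List.Membership.Propositional using (lose; find)
open import Data.List.Membership.Propositional.Properties
  using (∈-filter⁺; ∈-filter⁻; ∈-map⁺; ∈-map⁻; ∈-++⁺ˡ; ∈-++⁺ʳ; ∈-allFin)
open import Data.List.Membership.Setoid.Properties using (index-injective)
open import Data.List.NonEmpty using (List⁺) renaming (_∷_ to _∷⁺_)
import Data.List.NonEmpty as List⁺
open import Data.List.Properties using (filter-accept; filter-reject; filter-none; length-filter; length-map; length-tabulate)
import Data.List.Relation.Unary.All as All
import Data.List.Relation.Unary.All.Properties as All
open import Data.List.Relation.Unary.Any using (Any; here; there; index)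
import Data.List.Relation.Unary.Any as Any
import Data.List.Relation.Unary.Any.Properties as Any
open import Data.Nat using (zero; suc; s≤s; z≤n; _≡ᵇ_)
open import Data.Nat.ListAction using (sum)
open import Data.Nat.Properties using (≤-trans; ≤-reflexive; m≤m+n; +-mono-≤; *-mono-≤; module ≤-Reasoning)
open import Data.Nat.Tactic.RingSolver using (solve-∀)
open import Data.Product using (_,_; proj₁; proj₂)
open import Data.Sum using (inj₁; inj₂; [_,_])
open import Data.Vec using (lookup; []; _∷_)
open import Data.Vec.Properties using ([]=⇒lookup; lookup⇒[]=)
open import Function using (_∘_; id)
open import Function.Bundles using (mk⇔; Equivalence)
open import Induction.WellFounded using (Acc; acc)
open import Relation.Binary.PropositionalEquality using (_≡_; refl; sym; trans; cong; subst; setoid)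
open import Relation.Nullary using (¬_; yes; no; ¬?)
open import Relation.Nullary.Decidable using (_×-dec_; decidable-stable)

open Equivalence using (to; from)

module _ {A : Set} (p : A → Bool) where

  ∈-filterᵇ⁺ : ∀ {x xs} → x ∈ xs → p x ≡ true → x ∈ filterᵇ p xs
  ∈-filterᵇ⁺ x∈xs px = ∈-filter⁺ (T? ∘ p) x∈xs (from T-≡ px)

  ∈-filterᵇ⁻ : ∀ {x xs} → x ∈ filterᵇ p xs → x ∈ xs × p x ≡ true
  ∈-filterᵇ⁻ x∈ = let x∈xs , px = ∈-filter⁻ (T? ∘ p) x∈ in x∈xs , to T-≡ px

  length-filterᵇ-tabulate≡1 : ∀ {n} (f : Fin n → A) {x} → p (f x) ≡ true →
                              (∀ i → p (f i) ≡ true → i ≡ x) →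
                              length (filterᵇ p (tabulate f)) ≡ 1
  length-filterᵇ-tabulate≡1 {suc n} f {zero} px unique =
    cong length (trans (filter-accept (T? ∘ p) (from T-≡ px))
                       (cong (f zero ∷_) (filter-none (T? ∘ p) (All.tabulate⁺ none))))
    where
    none : ∀ i → ¬ T (p (f (suc i)))
    none i pi = 0≢1+n (sym (unique (suc i) (to T-≡ pi)))
  length-filterᵇ-tabulate≡1 {suc n} f {suc x} px unique =
    trans (cong length (filter-reject (T? ∘ p) (λ p0 → 0≢1+n (unique zero (to T-≡ p0)))))
          (length-filterᵇ-tabulate≡1 (f ∘ suc) px (λ i pi → suc-injective (unique (suc i) pi)))

sum-map-≤ : ∀ {A : Set} (f : A → ℕ) {k} xs → All (λ x → f x ≤ k) xs → sum (map f xs) ≤ length xs * k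
sum-map-≤ f []       All.[]         = z≤n
sum-map-≤ f (x ∷ xs) (fx≤k All.∷ h) = +-mono-≤ fx≤k (sum-map-≤ f xs h)

∧-≡-true : ∀ {a b} → a ∧ b ≡ true ⇔ (a ≡ true × b ≡ true)
∧-≡-true {true}  = mk⇔ (refl ,_) proj₂
∧-≡-true {false} = mk⇔ (λ ()) (λ { (() , _) })

∈-allSubsets : ∀ {n} (S : Subset n) → S ∈ allSubsets n
∈-allSubsets []          = here refl
∈-allSubsets {suc n} (true ∷ S)  = ∈-++⁺ˡ (∈-map⁺ (true ∷_) (∈-allSubsets S))
∈-allSubsets {suc n} (false ∷ S) = ∈-++⁺ʳ (map (true ∷_) (allSubsets n)) (∈-map⁺ (false ∷_) (∈-allSubsets S))

module _ {n : ℕ} where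

  ∈ˢ⇔lookup : ∀ {x : Fin n} {S} → x ∈ˢ S ⇔ lookup S x ≡ true
  ∈ˢ⇔lookup = mk⇔ []=⇒lookup (lookup⇒[]= _ _)

  elements : Subset n → List (Fin n)
  elements S = filterᵇ (lookup S) (allFin n)

  length-elements : ∀ S → length (elements S) ≤ n
  length-elements S = ≤-trans (length-filter (T? ∘ lookup S) (allFin n)) (≤-reflexive (length-tabulate id))

  All-elements⇔ : ∀ {S T} → All (_∈ˢ T) (elements S) ⇔ S ⊆ T
  All-elements⇔ {S} = mk⇔
    (λ h {x} x∈S → All.lookup h (∈-filterᵇ⁺ _ (∈-allFin _) (to ∈ˢ⇔lookup x∈S)))
    (λ S⊆T → All.tabulate (λ x∈ → S⊆T (from ∈ˢ⇔lookup (proj₂ (∈-filterᵇ⁻ (lookup S) {xs = allFin n} x∈)))))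

module _ {n : ℕ} (F : Family n) where

  Endpoint : Subset n → Fin n → Set
  Endpoint G g = isEndpointᵇ F G g ≡ true

  endpoint⇔ : ∀ G g → Endpoint G g ⇔ (g ∈ˢ G × Feasible F (G - g))
  endpoint⇔ G g = mk⇔ (λ ep → let g∈G , F[G-g] = to ∧-≡-true ep in from ∈ˢ⇔lookup g∈G , F[G-g])
                      (λ (g∈G , F[G-g]) → from ∧-≡-true (to ∈ˢ⇔lookup g∈G , F[G-g]))

  record IsPathTo (x : Fin n) (P : Subset n) : Set where
    field
      feasible : Feasible F P
      endpoint : Endpoint P x
      unique   : ∀ g → Endpoint P g → g ≡ x

  isPathᵇ-true : ∀ {x P} → IsPathTo x P → isPathᵇ F P ≡ true
  isPathᵇ-true {x} {P} path =
    from ∧-≡-true (feasible , cong (_≡ᵇ 1) (length-filterᵇ-tabulate≡1 (isEndpointᵇ F P) id endpoint unique))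
    where open IsPathTo path

module Antimatroid {n : ℕ} {F : Family n} (AM : IsAntimatroid F) where
  open IsAntimatroid AM

  record Trim (A S : Subset n) : Set where
    field
      core        : Subset n
      feasible    : Feasible F core
      ⊇A          : A ⊆ core
      ⊆S          : core ⊆ S
      endpoints⊆A : ∀ {g} → Endpoint F core g → g ∈ˢ A

  Trim-widen : ∀ {A S S′} → S ⊆ S′ → Trim A S → Trim A S′
  Trim-widen S⊆S′ t = record { Trim t ; ⊆S = ⊆-trans (Trim.⊆S t) S⊆S′ }

  trimAcc : ∀ {A S} → Acc _⊂_ S → Feasible F S → A ⊆ S → Trim A S
  trimAcc {A} {S} (acc smaller) FS A⊆S
    with any? (λ g → (isEndpointᵇ F S g ≟ᵇ true) ×-dec ¬? (g ∈? A))
  ... | yes (g , ep , g∉A) = Trim-widen (p─q⊆p S ⁅ g ⁆) t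
    where
    g∈S = proj₁ (to (endpoint⇔ F S g) ep)
    t = trimAcc (smaller (x∈p⇒p-x⊂p g∈S)) (proj₂ (to (endpoint⇔ F S g) ep))
                (λ a∈A → x∈p∧x≢y⇒x∈p-y (A⊆S a∈A) (λ { refl → g∉A a∈A }))
  ... | no ¬∃ = record
    { core = S ; feasible = FS ; ⊇A = A⊆S ; ⊆S = ⊆-refl
    ; endpoints⊆A = λ {g} ep → decidable-stable (g ∈? A) (λ g∉A → ¬∃ (g , ep , g∉A)) }

  trim : ∀ {A S} → Feasible F S → A ⊆ S → Trim A S
  trim = trimAcc (⊂-wellFounded _)

  ∅-feasible : Feasible F ⊥
  ∅-feasible = subst (Feasible F) (Empty-unique empty) feasible
    where
    open Trim (trim full-feasible (⊆-min ⊤))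
    empty : Empty core
    empty g∈core = let _ , h∈core , F[core-h] = accessible core feasible g∈core
                   in ∉⊥ (endpoints⊆A (from (endpoint⇔ F core _) (h∈core , F[core-h])))

  path-within : ∀ {S x} → Feasible F S → x ∈ˢ S → ∃ λ P → P ⊆ S × IsPathTo F x P
  path-within {S} {x} FS x∈S = core , ⊆S , record { feasible = feasible ; endpoint = endpoint ; unique = unique }
    where
    open Trim (trim {⁅ x ⁆} FS (λ g∈⁅x⁆ → subst (_∈ˢ S) (sym (x∈⁅y⁆⇒x≡y x g∈⁅x⁆)) x∈S))
    unique : ∀ g → Endpoint F core g → g ≡ x
    unique g ep = x∈⁅y⁆⇒x≡y x (endpoints⊆A ep)
    endpoint : Endpoint F core x
    endpoint = let g , g∈core , F[core-g] = accessible core feasible (x , ⊇A (x∈⁅x⁆ x))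
                   ep = from (endpoint⇔ F core g) (g∈core , F[core-g])
               in subst (Endpoint F core) (unique g ep) ep

  feasible-if-covered : ∀ T → (∀ {x} → x ∈ˢ T → ∃ λ P → Feasible F P × x ∈ˢ P × P ⊆ T) → Feasible F T
  feasible-if-covered T covered =
    let U , FU , U⊆T , covers = union (allFin n)
    in subst (Feasible F) (⊆-antisym U⊆T (λ {x} x∈T → covers (∈-allFin x) x∈T)) FU
    where
    union : ∀ xs → ∃ λ U → Feasible F U × U ⊆ T × (∀ {x} → x ∈ xs → x ∈ˢ T → x ∈ˢ U)
    union [] = ⊥ , ∅-feasible , ⊆-min T , λ ()
    union (x ∷ xs) with union xs | x ∈? T
    ... | U , FU , U⊆T , covers | no x∉T =
      U , FU , U⊆T , λ { (here refl) x∈T → ⊥-elim (x∉T x∈T) ; (there y∈xs) → covers y∈xs }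
    ... | U , FU , U⊆T , covers | yes x∈T =
      let P , FP , x∈P , P⊆T = covered x∈T in
      P ∪ U , union-closed P U FP FU ,
      (λ y∈P∪U → [ P⊆T , U⊆T ] (x∈p∪q⁻ P U y∈P∪U)) ,
      λ { (here refl) _ → x∈p∪q⁺ (inj₁ x∈P) ; (there y∈xs) y∈T → x∈p∪q⁺ (inj₂ (covers y∈xs y∈T)) }

module Construction {n : ℕ} {F : Family n} (AM : IsAntimatroid F) where
  open IsAntimatroid AM using (full-feasible)
  open Antimatroid AM

  paths : List (Subset n)
  paths = filterᵇ (isPathᵇ F) (allSubsets n)

  pathsTo : Fin n → List (Subset n)
  pathsTo x = filterᵇ (λ P → isEndpointᵇ F P x) paths

  path∈pathsTo : ∀ {x P} → IsPathTo F x P → P ∈ pathsTo x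
  path∈pathsTo path = ∈-filterᵇ⁺ _ (∈-filterᵇ⁺ (isPathᵇ F) (∈-allSubsets _) (isPathᵇ-true F path)) (IsPathTo.endpoint path)

  pathsTo-sound : ∀ {x P} → P ∈ pathsTo x → Feasible F P × x ∈ˢ P
  pathsTo-sound {x} {P} P∈ =
    let P∈paths , ep = ∈-filterᵇ⁻ (λ P → isEndpointᵇ F P x) {xs = paths} P∈
        _ , isPath = ∈-filterᵇ⁻ (isPathᵇ F) {xs = allSubsets n} P∈paths
    in proj₁ (to ∧-≡-true isPath) , proj₁ (to (endpoint⇔ F P x) ep)

  canonicalPath : Fin n → Subset n
  canonicalPath x = proj₁ (path-within full-feasible (∈⊤ {x = x}))

  canonicalPath-isPath : ∀ x → IsPathTo F x (canonicalPath x)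
  canonicalPath-isPath x = proj₂ (proj₂ (path-within full-feasible (∈⊤ {x = x})))

  candidates : Fin n → List (Subset n)
  candidates x = canonicalPath x ∷ pathsTo x

  candidate-sound : ∀ {x P} → P ∈ candidates x → Feasible F P × x ∈ˢ P
  candidate-sound {x} (here refl) = let open IsPathTo (canonicalPath-isPath x) in
                                     feasible , proj₁ (to (endpoint⇔ F _ x) endpoint)
  candidate-sound (there P∈) = pathsTo-sound P∈

  clause : Fin n → Subset n → List⁺ (Fin n)
  clause x P = x ∷⁺ elements P

  -- List⁺ needs a head clause; the canonical path supplies one (it occurs in pathsTo x as well).
  constraint : Fin n → ComplJoinConstraint n
  constraint x = cjc (x ∷⁺ []) (clause x (canonicalPath x) ∷⁺ map (clause x) (pathsTo x))

  Ω : List (ComplJoinConstraint n)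
  Ω = map constraint (allFin n)

  satisfies-constraint⇔ : ∀ {T x} → Satisfies T (constraint x) ⇔ (x ∈ˢ T → Any (_⊆ T) (candidates x))
  satisfies-constraint⇔ {T} {x} = mk⇔
    (λ sat x∈T → Any.map (to All-elements⇔ ∘ All.tail) (Any.map⁻ {xs = candidates x} (sat (here x∈T))))
    (λ { h (here x∈T) → Any.map⁺ (Any.map {P = _⊆ T} (λ P⊆T → x∈T All.∷ from All-elements⇔ P⊆T) (h x∈T)) })

  feasible⇔candidates-within : ∀ {T} → Feasible F T ⇔ (∀ x → x ∈ˢ T → Any (_⊆ T) (candidates x))
  feasible⇔candidates-within {T} = mk⇔
    (λ FT x x∈T → let _ , P⊆T , path = path-within FT x∈T in there (lose {P = _⊆ T} (path∈pathsTo path) P⊆T))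
    (λ h → feasible-if-covered T λ {x} x∈T →
      let P , P∈ , P⊆T = find (h x x∈T)
          FP , x∈P = candidate-sound P∈
      in P , FP , x∈P , P⊆T)

  feasible⇔satisfies-Ω : ∀ T → Feasible F T ⇔ (∀ ω → ω ∈ Ω → Satisfies T ω)
  feasible⇔satisfies-Ω T = mk⇔
    (λ FT ω ω∈Ω → let x , _ , ω≡ = ∈-map⁻ constraint ω∈Ω in
       subst (Satisfies T) (sym ω≡) (from satisfies-constraint⇔ (to feasible⇔candidates-within FT x)))
    (λ sat → from feasible⇔candidates-within λ x → to satisfies-constraint⇔ (sat _ (∈-map⁺ constraint (∈-allFin x))))

  length-Ω : length Ω ≡ n
  length-Ω = trans (length-map constraint (allFin n)) (length-tabulate id)

  canonicalPath-injective : ∀ {x y} → canonicalPath x ≡ canonicalPath y → x ≡ y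
  canonicalPath-injective {x} {y} same =
    IsPathTo.unique (canonicalPath-isPath y) x
      (subst (λ P → Endpoint F P x) same (IsPathTo.endpoint (canonicalPath-isPath x)))

  n≤numPaths : n ≤ numPaths F
  n≤numPaths = injective⇒≤ {f = index ∘ canonicalPath∈paths}
    (λ i≡j → canonicalPath-injective (index-injective (setoid _) (canonicalPath∈paths _) (canonicalPath∈paths _) i≡j))
    where
    canonicalPath∈paths : ∀ x → canonicalPath x ∈ paths
    canonicalPath∈paths x = ∈-filterᵇ⁺ (isPathᵇ F) (∈-allSubsets _) (isPathᵇ-true F (canonicalPath-isPath x))

  numArgs-constraint : ∀ x → numArgs (constraint x) ≤ suc (suc (numPaths F) * suc (numPaths F))
  numArgs-constraint x = s≤s (begin
    sum (map List⁺.length (map (clause x) (candidates x)))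
      ≤⟨ sum-map-≤ List⁺.length _ (All.map⁺ (All.universal (s≤s ∘ length-elements) (candidates x))) ⟩
    length (map (clause x) (candidates x)) * suc n
      ≤⟨ *-mono-≤ (≤-trans (≤-reflexive (length-map (clause x) (candidates x)))
                          (s≤s (length-filter (T? ∘ λ P → isEndpointᵇ F P x) paths)))
                  (s≤s n≤numPaths) ⟩
    suc (numPaths F) * suc (numPaths F) ∎)
    where open ≤-Reasoning

square-bound : ∀ q → suc (suc q * suc q) ≤ 4 * (q * q) + 4
square-bound zero    = s≤s (s≤s z≤n)
square-bound (suc r) = subst (suc (suc (suc r) * suc (suc r)) ≤_) (slack r) (m≤m+n _ (3 * (r * r) + 4 * r + 3))
  where
  slack : ∀ r → suc ((2 + r) * (2 + r)) + (3 * (r * r) + 4 * r + 3) ≡ 4 * ((1 + r) * (1 + r)) + 4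
  slack = solve-∀

lemma11 : ∃ λ (c : ℕ) → ∀ (n : ℕ) (F : Family n) → IsAntimatroid F →
              ∃ λ (Ω : List (ComplJoinConstraint n)) →
                (length Ω ≤ c * n + c)
                × All (λ ω → numArgs ω ≤ c * (numPaths F * numPaths F) + c) Ω
                × (∀ (T : Subset n) → Feasible F T ⇔ (∀ ω → ω ∈ Ω → Satisfies T ω))
lemma11 = 4 , λ n F AM → let open Construction AM in
  Ω ,
  ≤-trans (≤-reflexive length-Ω) (≤-trans (m≤m+n n (3 * n)) (m≤m+n (4 * n) 4)) ,
  All.map⁺ (All.tabulate⁺ λ x → ≤-trans (numArgs-constraint x) (square-bound (numPaths F))) ,
  feasible⇔satisfies-Ω
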